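{- Let $\langle U_n:n<\omega\rangle$ be a discrete sequence of ultrafilters on $\omega$, i.e. there are pairwise disjoint sets $A_n\in U_n$. Then $\bigcap_{n<\omega}U_n\equiv_T\prod_{n<\omega}U_n$.
   Context: $\bigcap_nU_n$ is the filter of sets belonging to every $U_n$, ordered by reverse inclusion; $\prod_nU_n$ is ordered coordinatewise by reverse inclusion. $P\le_TQ$ iff there is a map $Q\to P$ sending cofinal subsets to cofinal subsets; $\equiv_T$ means both directions. -}

module Defs where

open import Level using (0ℓ) renaming (suc to lsuc)
open import Data.Nat using (ℕ)
open import Data.Product using (Σ; _×_; _,_)
open import Data.Sum using (_⊎_)
open import Data.Empty using (⊥)
open import Relation.Nullary using (¬_)
open import Relation.Binary.PropositionalEquality using (_≡_; _≢_)
open import Relation.Unary using (Pred; _⊆_; _∈_; _∩_; ∁; ∅; U)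

SetOfℕ : Set₁
SetOfℕ = Pred ℕ 0ℓ

Family : Set₁
Family = Pred SetOfℕ 0ℓ

record IsUltrafilter (F : Family) : Set₁ where
  field
    hasFull   : F U
    noEmpty   : ¬ F ∅
    upward    : ∀ {A B} → A ⊆ B → F A → F B
    meet      : ∀ {A B} → F A → F B → F (A ∩ B)
    ultra     : ∀ A → F A ⊎ F (∁ A)

Discrete : (ℕ → Family) → Set₁
Discrete Us = Σ (ℕ → SetOfℕ) λ A →
  (∀ n → Us n (A n)) × (∀ m n k → m ≢ n → k ∈ A m → k ∈ A n → ⊥)

record OrderedSet : Set₂ where
  field
    Carrier : Set₁
    _≤_     : Carrier → Carrier → Set

open OrderedSet

Cofinal : (P : OrderedSet) → Pred (Carrier P) (lsuc 0ℓ) → Set₁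
Cofinal P X = ∀ p → Σ (Carrier P) λ q → X q × _≤_ P p q

Image : {A B : Set₁} → (A → B) → Pred A (lsuc 0ℓ) → Pred B (lsuc 0ℓ)
Image {A} f X b = Σ A λ a → X a × f a ≡ b

_≤T_ : OrderedSet → OrderedSet → Set₂
P ≤T Q = Σ (Carrier Q → Carrier P) λ f →
  ∀ (X : Pred (Carrier Q) (lsuc 0ℓ)) → Cofinal Q X → Cofinal P (Image f X)

_≡T_ : OrderedSet → OrderedSet → Set₂
P ≡T Q = (P ≤T Q) × (Q ≤T P)

IntersectionOrder : (ℕ → Family) → OrderedSet
IntersectionOrder Us = record
  { Carrier = Σ SetOfℕ (λ A → ∀ n → Us n A)
  ; _≤_ = λ { (A , _) (B , _) → B ⊆ A } }

ProductOrder : (ℕ → Family) → OrderedSet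
ProductOrder Us = record
  { Carrier = Σ (ℕ → SetOfℕ) (λ X → ∀ n → Us n (X n))
  ; _≤_ = λ { (X , _) (Y , _) → ∀ n → Y n ⊆ X n } }

{-# OPTIONS --safe #-}
module Submission where

-- Gluing X ∈ ∏ U_n into ⋃_m (X m ∩ A m) lands in ⋂ U_n, and restricting B ∈ ⋂ U_n
-- to (B ∩ A n)_n lands in ∏ U_n. As the A n are disjoint, the part of the glued set
-- inside A n comes from X n alone, so gluing is adjoint both to the constant map
-- B ↦ (B)_n and to restriction; each such adjunction g ⊣ f makes f a Tukey map.

open import Defs
open import Data.Nat using (ℕ; _≟_)
open import Data.Product using (Σ; _×_; _,_)
open import Data.Empty using (⊥; ⊥-elim)
open import Relation.Nullary using (yes; no)
open import Relation.Binary.PropositionalEquality using (refl; _≢_)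
open import Relation.Unary using (_∈_; _⊆_; _∩_)

open OrderedSet

≤T-fromGaloisConnection : {P Q : OrderedSet}
  (f : Carrier Q → Carrier P) (g : Carrier P → Carrier Q) →
  (∀ p q → _≤_ Q (g p) q → _≤_ P p (f q)) → P ≤T Q
≤T-fromGaloisConnection f g adjoint = f , image-cofinal
  where
  image-cofinal : ∀ X → Cofinal _ X → Cofinal _ (Image f X)
  image-cofinal X X-cofinal p with X-cofinal (g p)
  ... | q , q∈X , gp≤q = f q , (q , q∈X , refl) , adjoint p q gp≤q

record IsFilter (F : Family) : Set₁ where
  field
    upward : ∀ {A B} → A ⊆ B → F A → F B
    meet   : ∀ {A B} → F A → F B → F (A ∩ B)

ultrafilter⇒filter : ∀ {F} → IsUltrafilter F → IsFilter F
ultrafilter⇒filter F-ultra = record { upward = upward ; meet = meet }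
  where open IsUltrafilter F-ultra

constant : (Us : ℕ → Family) → Carrier (IntersectionOrder Us) → Carrier (ProductOrder Us)
constant Us (B , B∈U) = (λ _ → B) , B∈U

module Gluing (Us : ℕ → Family) (filters : ∀ n → IsFilter (Us n))
              (A : ℕ → SetOfℕ) (A∈U : ∀ n → Us n (A n)) where

  open IsFilter

  glue : Carrier (ProductOrder Us) → Carrier (IntersectionOrder Us)
  glue (X , X∈U) = (λ k → Σ ℕ λ m → X m k × A m k) ,
    λ n → upward (filters n) (λ x∈X∩A → n , x∈X∩A) (meet (filters n) (X∈U n) (A∈U n))

  restrict : Carrier (IntersectionOrder Us) → Carrier (ProductOrder Us)
  restrict (B , B∈U) = (λ n → B ∩ A n) , λ n → meet (filters n) (B∈U n) (A∈U n)

  constant-glue-adjoint : ∀ B X →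
    _≤_ (ProductOrder Us) (constant Us B) X → _≤_ (IntersectionOrder Us) B (glue X)
  constant-glue-adjoint B X X⊆B (m , x∈Xm , _) = X⊆B m x∈Xm

  glue-restrict-adjoint : (∀ m n k → m ≢ n → k ∈ A m → k ∈ A n → ⊥) → ∀ X B →
    _≤_ (IntersectionOrder Us) (glue X) B → _≤_ (ProductOrder Us) X (restrict B)
  glue-restrict-adjoint disjoint X B B⊆glueX n {k} (k∈B , k∈An) with B⊆glueX k∈B
  ... | m , k∈Xm , k∈Am with m ≟ n
  ...   | yes refl = k∈Xm
  ...   | no m≢n   = ⊥-elim (disjoint m n k m≢n k∈Am k∈An)

proposition3p17 : (Us : ℕ → Family) → (∀ n → IsUltrafilter (Us n)) → Discrete Us →
    IntersectionOrder Us ≡T ProductOrder Us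
proposition3p17 Us ultra (A , A∈U , disjoint) =
    ≤T-fromGaloisConnection glue (constant Us) constant-glue-adjoint
  , ≤T-fromGaloisConnection restrict glue (glue-restrict-adjoint disjoint)
  where
  open Gluing Us (λ n → ultrafilter⇒filter (ultra n)) A A∈U
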